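{- For every rectangular permutation $\pi$ in the domain of the respective operator: $\psi_1(\pi)$, $\psi_2(\pi)$ and $\psi_u(\pi)$ each have the same number of recoils as $\pi$, and $\psi_d(\pi)$ has exactly one more recoil than $\pi$.
   Context: Permutations are in one-line form. A recoil of $\pi\in S_n$ is a value $i\in\{1,\dots,n-1\}$ such that $i$ occurs after $i+1$ in $\pi$. A permutation is rectangular if it avoids each of $2413, 2431, 4213, 4231$. For $\pi\in S_n$, $1\le i,j\le n+1$, $\rho_{i,j}(\pi)\in S_{n+1}$ increases by $1$ every entry $\ge i$ and inserts the value $i$ at position $j$. $\psi_1=\rho_{1,1}$ with domain all rectangular permutations; $\psi_2=\rho_{1,2}$ with domain the rectangular $\pi$ of size $\ge2$ with $\pi_1\ne1$; $\psi_u(\pi)=\rho_{\pi_1,1}(\pi)$ with domain the rectangular $\pi$ of size $\ge2$ with $\pi_1\ne1$; $\psi_d(\pi)=\rho_{\pi_1+1,1}(\pi)$ with domain the rectangular $\pi$ of size $\ge1$. -}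

module Defs where

open import Data.Nat using (ℕ; zero; suc; _<_; _≤ᵇ_; _<?_)
open import Data.Bool using (if_then_else_)
open import Data.List using (List; []; _∷_; map; upTo; length; filter)
open import Data.List.Relation.Binary.Permutation.Propositional using (_↭_)
open import Data.List.Relation.Binary.Sublist.Propositional using (_⊆_)
open import Data.List.Relation.Binary.Pointwise using (Pointwise)
open import Data.Product using (∃; _×_)
open import Function.Bundles using (_⇔_)
open import Relation.Nullary using (¬_)

IsPerm : List ℕ → Set
IsPerm π = π ↭ map suc (upTo (length π))

data OrdIso : List ℕ → List ℕ → Set where
  nil  : OrdIso [] []
  cons : ∀ {x y xs ys} →
         Pointwise (λ x′ y′ → (x < x′) ⇔ (y < y′)) xs ys →
         Pointwise (λ x′ y′ → (x′ < x) ⇔ (y′ < y)) xs ys →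
         OrdIso xs ys → OrdIso (x ∷ xs) (y ∷ ys)

Contains : List ℕ → List ℕ → Set
Contains π σ = ∃ λ s → s ⊆ π × OrdIso s σ

Avoids : List ℕ → List ℕ → Set
Avoids π σ = ¬ Contains π σ

Rectangular : List ℕ → Set
Rectangular π =
  Avoids π (2 ∷ 4 ∷ 1 ∷ 3 ∷ []) × Avoids π (2 ∷ 4 ∷ 3 ∷ 1 ∷ []) ×
  Avoids π (4 ∷ 2 ∷ 1 ∷ 3 ∷ []) × Avoids π (4 ∷ 2 ∷ 3 ∷ 1 ∷ [])

-- 0-based position of the first occurrence of v in a list (length if absent).
pos : ℕ → List ℕ → ℕ
pos v [] = 0
pos v (x ∷ xs) = if x ≤ᵇ v then (if v ≤ᵇ x then 0 else suc (pos v xs)) else suc (pos v xs)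

recoilList : List ℕ → List ℕ
recoilList π = filter (λ i → pos (suc i) π <? pos i π) (map suc (upTo (length π Data.Nat.∸ 1)))

recoils : List ℕ → ℕ
recoils π = length (recoilList π)

-- Insert value v at (1-based) position j.
insertAt : ℕ → ℕ → List ℕ → List ℕ
insertAt zero v xs = v ∷ xs
insertAt (suc zero) v xs = v ∷ xs
insertAt (suc (suc j)) v [] = v ∷ []
insertAt (suc (suc j)) v (x ∷ xs) = x ∷ insertAt (suc j) v xs

ρ : ℕ → ℕ → List ℕ → List ℕ
ρ i j π = insertAt j i (map (λ x → if i ≤ᵇ x then suc x else x) π)

-- first entry π₁ (only used when π is nonempty)
first : List ℕ → ℕ
first [] = 0
first (x ∷ _) = x

ψ₁ ψ₂ ψu ψd : List ℕ → List ℕ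
ψ₁ π = ρ 1 1 π
ψ₂ π = ρ 1 2 π
ψu π = ρ (first π) 1 π
ψd π = ρ (suc (first π)) 1 π

-- Whether v is a recoil depends only on the order of the positions of v and v+1, and the
-- old entries are moved by a strictly increasing map of positions (x ↦ x+1, or for ψ₂ the
-- map skipping position 1). So there is a value j+1 (1, 1, π₁, π₁ respectively) below which
-- the recoil indicators of the image agree with those of π, above which they agree with
-- those of π one value lower, and the recoil count changes by the indicator at j+1 alone.
-- That is 0 for ψ₁ and ψ₂ (1 precedes 2, as π₁ ≠ 1) and for ψu (π₁ precedes π₁+1), and 1
-- for ψd (π₁+1 precedes π₁).
module Submission where

open import Defs
open import Data.Bool.Base using (Bool; true; false; if_then_else_)
open import Data.List using (List; []; _∷_; length; map; applyUpTo; filter)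
open import Data.List.Properties using (length-map; map-upTo)
open import Data.List.Membership.Propositional using (_∈_)
open import Data.List.Membership.Propositional.Properties using (∈-map⁻; ∈-upTo⁻)
open import Data.List.Relation.Binary.Permutation.Propositional.Properties using (∈-resp-↭)
open import Data.List.Relation.Unary.Any using (here)
open import Data.Nat using (ℕ; zero; suc; _≤_; _<_; _+_; _∸_; _≤ᵇ_; _≤?_; _<?_; z≤n; s≤s)
open import Data.Nat.Properties
open import Algebra.Properties.CommutativeSemigroup +-commutativeSemigroup using (x∙yz≈y∙xz)
open import Data.Product using (_×_; _,_)
open import Data.Sum using (inj₁; inj₂)
open import Function.Base using (_∘_)
open import Function.Bundles using (mk⇔)
open import Function.Definitions using (Injective)
open import Relation.Binary.Core using (_Preserves_⟶_)
open import Relation.Binary.Definitions using (tri<; tri≈; tri>)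
open import Relation.Binary.PropositionalEquality
  using (_≡_; _≢_; refl; sym; trans; cong; cong₂; subst; ≢-sym; module ≡-Reasoning)
open import Relation.Nullary using (yes; no; does; contradiction)
open import Relation.Nullary.Decidable using (dec-true; dec-false; does-⇔)
open import Relation.Unary using (Decidable)

indicator : Bool → ℕ
indicator true  = 1
indicator false = 0

countBelow : ℕ → (ℕ → Bool) → ℕ
countBelow zero    b = 0
countBelow (suc n) b = indicator (b 0) + countBelow n (b ∘ suc)

countBelow-cong : ∀ n {b c : ℕ → Bool} →
  (∀ i → i < n → b i ≡ c i) → countBelow n b ≡ countBelow n c
countBelow-cong zero    b≡c = refl
countBelow-cong (suc n) b≡c =
  cong₂ _+_ (cong indicator (b≡c 0 (s≤s z≤n)))
            (countBelow-cong n (λ i i<n → b≡c (suc i) (s≤s i<n)))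

countBelow-insert : ∀ j r {b c : ℕ → Bool} →
  (∀ i → i < j → b i ≡ c i) → (∀ i → b (suc (j + i)) ≡ c (j + i)) →
  countBelow (suc (j + r)) b ≡ indicator (b j) + countBelow (j + r) c
countBelow-insert zero    r {b} below above =
  cong (indicator (b 0) +_) (countBelow-cong r (λ i _ → above i))
countBelow-insert (suc j) r {b} {c} below above = begin
  indicator (b 0) + countBelow (suc (j + r)) (b ∘ suc)
    ≡⟨ cong₂ _+_ (cong indicator (below 0 (s≤s z≤n)))
                 (countBelow-insert j r (λ i i<j → below (suc i) (s≤s i<j)) above) ⟩
  indicator (c 0) + (indicator (b (suc j)) + countBelow (j + r) (c ∘ suc))
    ≡⟨ x∙yz≈y∙xz (indicator (c 0)) (indicator (b (suc j))) (countBelow (j + r) (c ∘ suc)) ⟩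
  indicator (b (suc j)) + countBelow (suc j + r) c ∎
  where open ≡-Reasoning

length-filter-applyUpTo : ∀ {P : ℕ → Set} (P? : Decidable P) (f : ℕ → ℕ) n →
  length (filter P? (applyUpTo f n)) ≡ countBelow n (λ i → does (P? (f i)))
length-filter-applyUpTo P? f zero = refl
length-filter-applyUpTo P? f (suc n) with does (P? (f 0))
... | true  = cong suc (length-filter-applyUpTo P? (f ∘ suc) n)
... | false = length-filter-applyUpTo P? (f ∘ suc) n

isRecoil : List ℕ → ℕ → Bool
isRecoil π v = does (pos (suc v) π <? pos v π)

recoils≡countBelow : ∀ π → recoils π ≡ countBelow (length π ∸ 1) (isRecoil π ∘ suc)
recoils≡countBelow π rewrite map-upTo suc (length π ∸ 1) =
  length-filter-applyUpTo (λ i → pos (suc i) π <? pos i π) suc (length π ∸ 1)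

recoils-insert : ∀ σ π j {e} → j < length π → length σ ≡ suc (length π) →
  (∀ i → i < j → isRecoil σ (suc i) ≡ isRecoil π (suc i)) →
  (∀ i → isRecoil σ (suc (suc (j + i))) ≡ isRecoil π (suc (j + i))) →
  isRecoil σ (suc j) ≡ e →
  recoils σ ≡ indicator e + recoils π
recoils-insert σ π j {e} j<|π| |σ|≡ below above new = begin
  recoils σ
    ≡⟨ recoils≡countBelow σ ⟩
  countBelow (length σ ∸ 1) (isRecoil σ ∘ suc)
    ≡⟨ cong (λ m → countBelow m (isRecoil σ ∘ suc)) (trans (cong (_∸ 1) |σ|≡) (sym |π|≡)) ⟩
  countBelow (suc (j + r)) (isRecoil σ ∘ suc)
    ≡⟨ countBelow-insert j r below above ⟩
  indicator (isRecoil σ (suc j)) + countBelow (j + r) (isRecoil π ∘ suc)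
    ≡⟨ cong₂ (λ b m → indicator b + countBelow m (isRecoil π ∘ suc)) new (cong (_∸ 1) |π|≡) ⟩
  indicator e + countBelow (length π ∸ 1) (isRecoil π ∘ suc)
    ≡⟨ cong (indicator e +_) (recoils≡countBelow π) ⟨
  indicator e + recoils π ∎
  where
  open ≡-Reasoning
  r = length π ∸ suc j
  |π|≡ : suc (j + r) ≡ length π
  |π|≡ = m+[n∸m]≡n j<|π|

<-reflected : ∀ {f : ℕ → ℕ} → f Preserves _<_ ⟶ _<_ → ∀ {a b} → f a < f b → a < b
<-reflected mono {a} {b} fa<fb with <-cmp a b
... | tri< a<b _ _ = a<b
... | tri≈ _ refl _ = contradiction fa<fb (<-irrefl refl)
... | tri> _ _ b<a = contradiction (mono b<a) (<-asym fa<fb)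

isRecoil-transport : ∀ {σ π v w} (f : ℕ → ℕ) → f Preserves _<_ ⟶ _<_ →
  pos (suc v) σ ≡ f (pos (suc w) π) → pos v σ ≡ f (pos w π) →
  isRecoil σ v ≡ isRecoil π w
isRecoil-transport {σ} {π} {v} {w} f mono eq₁ eq₂ rewrite eq₁ | eq₂ =
  does-⇔ (mk⇔ (<-reflected mono) mono)
    (f (pos (suc w) π) <? f (pos w π)) (pos (suc w) π <? pos w π)

-- does (m ≤? n) is definitionally m ≤ᵇ n, so dec-true/dec-false rewrite the tests in pos.
pos-head : ∀ v xs → pos v (v ∷ xs) ≡ 0
pos-head v xs rewrite dec-true (v ≤? v) ≤-refl = refl

pos-tail : ∀ {x v} xs → x ≢ v → pos v (x ∷ xs) ≡ suc (pos v xs)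
pos-tail {x} {v} xs x≢v with <-cmp x v
... | tri< x<v _ _ rewrite dec-true (x ≤? v) (<⇒≤ x<v) | dec-false (v ≤? x) (<⇒≱ x<v) = refl
... | tri≈ _ x≡v _ = contradiction x≡v x≢v
... | tri> _ _ v<x rewrite dec-false (x ≤? v) (<⇒≱ v<x) = refl

pos-map : ∀ {f : ℕ → ℕ} → Injective _≡_ _≡_ f → ∀ v xs → pos (f v) (map f xs) ≡ pos v xs
pos-map f-inj v [] = refl
pos-map {f} f-inj v (x ∷ xs) with x ≟ v
... | yes refl = trans (pos-head (f x) (map f xs)) (sym (pos-head x xs))
... | no x≢v = trans (pos-tail (map f xs) (λ fx≡fv → x≢v (f-inj fx≡fv)))
                     (trans (cong suc (pos-map f-inj v xs)) (sym (pos-tail xs x≢v)))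

-- ρ k 1 π reduces to k ∷ map (bump k) π.
bump : ℕ → ℕ → ℕ
bump k x = if k ≤ᵇ x then suc x else x

bump-≥ : ∀ {k x} → k ≤ x → bump k x ≡ suc x
bump-≥ {k} {x} k≤x rewrite dec-true (k ≤? x) k≤x = refl

bump-< : ∀ {k x} → x < k → bump k x ≡ x
bump-< {k} {x} x<k rewrite dec-false (k ≤? x) (<⇒≱ x<k) = refl

bump-preserves-≥ : ∀ {k x} → k ≤ x → k ≤ bump k x
bump-preserves-≥ {k} k≤x = subst (k ≤_) (sym (bump-≥ k≤x)) (m≤n⇒m≤1+n k≤x)

bump-preserves-< : ∀ {k x} → x < k → bump k x < k
bump-preserves-< {k} x<k = subst (_< k) (sym (bump-< x<k)) x<k

bump-injective : ∀ k → Injective _≡_ _≡_ (bump k)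
bump-injective k {x} {y} eq with k ≤? x | k ≤? y
... | yes k≤x | yes k≤y = suc-injective (trans (sym (bump-≥ k≤x)) (trans eq (bump-≥ k≤y)))
... | no k≰x  | no k≰y  = trans (sym (bump-< (≰⇒> k≰x))) (trans eq (bump-< (≰⇒> k≰y)))
... | yes k≤x | no k≰y  =
  contradiction (subst (k ≤_) eq (bump-preserves-≥ k≤x)) (<⇒≱ (bump-preserves-< (≰⇒> k≰y)))
... | no k≰x  | yes k≤y =
  contradiction (subst (k ≤_) (sym eq) (bump-preserves-≥ k≤y)) (<⇒≱ (bump-preserves-< (≰⇒> k≰x)))

bump-≢ : ∀ k x → k ≢ bump k x
bump-≢ k x with k ≤? x
... | yes k≤x = <⇒≢ (subst (k <_) (sym (bump-≥ k≤x)) (s≤s k≤x))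
... | no k≰x  = ≢-sym (<⇒≢ (bump-preserves-< (≰⇒> k≰x)))

pos-prepend : ∀ k π w → pos (bump k w) (ρ k 1 π) ≡ suc (pos w π)
pos-prepend k π w =
  trans (pos-tail (map (bump k) π) (bump-≢ k w)) (cong suc (pos-map (bump-injective k) w π))

pos-prepend-≥ : ∀ {k w} π → k ≤ w → pos (suc w) (ρ k 1 π) ≡ suc (pos w π)
pos-prepend-≥ {k} {w} π k≤w =
  trans (cong (λ x → pos x (ρ k 1 π)) (sym (bump-≥ k≤w))) (pos-prepend k π w)

pos-prepend-< : ∀ {k w} π → w < k → pos w (ρ k 1 π) ≡ suc (pos w π)
pos-prepend-< {k} {w} π w<k =
  trans (cong (λ x → pos x (ρ k 1 π)) (sym (bump-< w<k))) (pos-prepend k π w)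

isRecoil-prepend-≥ : ∀ {k w} π → k ≤ w → isRecoil (ρ k 1 π) (suc w) ≡ isRecoil π w
isRecoil-prepend-≥ {k} {w} π k≤w =
  isRecoil-transport {ρ k 1 π} {π} {suc w} {w} suc s≤s
    (pos-prepend-≥ π (m≤n⇒m≤1+n k≤w)) (pos-prepend-≥ π k≤w)

isRecoil-prepend-< : ∀ {k w} π → suc w < k → isRecoil (ρ k 1 π) w ≡ isRecoil π w
isRecoil-prepend-< {k} {w} π sw<k =
  isRecoil-transport {ρ k 1 π} {π} {w} {w} suc s≤s
    (pos-prepend-< π sw<k) (pos-prepend-< π (<-trans (n<1+n w) sw<k))

isRecoil-head : ∀ v xs → isRecoil (v ∷ xs) v ≡ false
isRecoil-head v xs rewrite pos-head v xs = dec-false (pos (suc v) (v ∷ xs) <? 0) n≮0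

isRecoil-head-pred : ∀ v xs → isRecoil (suc v ∷ xs) v ≡ true
isRecoil-head-pred v xs rewrite pos-head (suc v) xs | pos-tail xs (1+n≢n {v}) = refl

skipOne : ℕ → ℕ
skipOne zero    = zero
skipOne (suc x) = suc (suc x)

skipOne-mono : skipOne Preserves _<_ ⟶ _<_
skipOne-mono {zero}  {suc y} _       = s≤s z≤n
skipOne-mono {suc x} {suc y} (s≤s x<y) = s≤s (s≤s x<y)

pos-ψ₂ : ∀ p rest w → pos (bump 1 w) (ψ₂ (p ∷ rest)) ≡ skipOne (pos w (p ∷ rest))
pos-ψ₂ p rest w with p ≟ w
... | yes refl = trans (pos-head (bump 1 p) (ρ 1 1 rest)) (cong skipOne (sym (pos-head p rest)))
... | no p≢w = begin
  pos (bump 1 w) (bump 1 p ∷ ρ 1 1 rest) ≡⟨ pos-tail (ρ 1 1 rest) (λ eq → p≢w (bump-injective 1 eq)) ⟩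
  suc (pos (bump 1 w) (ρ 1 1 rest))      ≡⟨ cong suc (pos-prepend 1 rest w) ⟩
  skipOne (suc (pos w rest))             ≡⟨ cong skipOne (pos-tail rest p≢w) ⟨
  skipOne (pos w (p ∷ rest))             ∎
  where open ≡-Reasoning

isRecoil-ψ₂-one : ∀ {p} rest → p ≢ 1 → isRecoil (ψ₂ (p ∷ rest)) 1 ≡ false
isRecoil-ψ₂-one {p} rest p≢1
  rewrite pos-ψ₂ p rest 1 | pos-tail rest p≢1
        | pos-tail (ρ 1 1 rest) (≢-sym (bump-≢ 1 p)) | pos-head 1 (map (bump 1) rest) = refl

recoils-ψ₁ : ∀ π → recoils (ψ₁ π) ≡ recoils π
recoils-ψ₁ [] = refl
recoils-ψ₁ π@(_ ∷ _) =
  recoils-insert (ψ₁ π) π 0 (s≤s z≤n) (cong suc (length-map (bump 1) π)) (λ _ ())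
    (λ _ → isRecoil-prepend-≥ π (s≤s z≤n)) (isRecoil-head 1 (map (bump 1) π))

recoils-ψ₂ : ∀ {p} rest → p ≢ 1 → recoils (ψ₂ (p ∷ rest)) ≡ recoils (p ∷ rest)
recoils-ψ₂ {p} rest p≢1 =
  recoils-insert (ψ₂ (p ∷ rest)) (p ∷ rest) 0 (s≤s z≤n)
    (cong (suc ∘ suc) (length-map (bump 1) rest)) (λ _ ())
    (λ i → isRecoil-transport {ψ₂ (p ∷ rest)} {p ∷ rest} skipOne skipOne-mono
             (pos-ψ₂ p rest (suc (suc i))) (pos-ψ₂ p rest (suc i)))
    (isRecoil-ψ₂-one rest p≢1)

isRecoil-ψu-< : ∀ {p v} rest → v < p → isRecoil (ψu (p ∷ rest)) v ≡ isRecoil (p ∷ rest) v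
isRecoil-ψu-< {p} {v} rest v<p with m≤n⇒m<n∨m≡n v<p
... | inj₁ sv<p = isRecoil-prepend-< (p ∷ rest) sv<p
... | inj₂ refl = trans (isRecoil-head-pred v (map (bump (suc v)) (suc v ∷ rest)))
                        (sym (isRecoil-head-pred v rest))

recoils-ψu : ∀ {j} rest → j ≤ length rest → recoils (ψu (suc j ∷ rest)) ≡ recoils (suc j ∷ rest)
recoils-ψu {j} rest j≤ =
  recoils-insert (ψu π) π j (s≤s j≤) (cong suc (length-map (bump (suc j)) π))
    (λ i i<j → isRecoil-ψu-< rest (s≤s i<j))
    (λ i → isRecoil-prepend-≥ π (s≤s (m≤m+n j i)))
    (isRecoil-head (suc j) (map (bump (suc j)) π))
  where π = suc j ∷ rest

isRecoil-ψd-≥ : ∀ {p w} rest → p ≤ w → isRecoil (ψd (p ∷ rest)) (suc w) ≡ isRecoil (p ∷ rest) w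
isRecoil-ψd-≥ {p} rest p≤w with m≤n⇒m<n∨m≡n p≤w
... | inj₁ p<w  = isRecoil-prepend-≥ (p ∷ rest) p<w
... | inj₂ refl = trans (isRecoil-head (suc p) (map (bump (suc p)) (p ∷ rest)))
                        (sym (isRecoil-head p rest))

recoils-ψd : ∀ {j} rest → j ≤ length rest → recoils (ψd (suc j ∷ rest)) ≡ suc (recoils (suc j ∷ rest))
recoils-ψd {j} rest j≤ =
  recoils-insert (ψd π) π j (s≤s j≤) (cong suc (length-map (bump (suc (suc j))) π))
    (λ i i<j → isRecoil-prepend-< π (s≤s (s≤s i<j)))
    (λ i → isRecoil-ψd-≥ rest (s≤s (m≤m+n j i)))
    (isRecoil-head-pred (suc j) (map (bump (suc (suc j))) π))
  where π = suc j ∷ rest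

∈-IsPerm-bounds : ∀ {π x} → IsPerm π → x ∈ π → 1 ≤ x × x ≤ length π
∈-IsPerm-bounds perm x∈π with ∈-map⁻ suc (∈-resp-↭ perm x∈π)
... | y , y∈ , refl = s≤s z≤n , ∈-upTo⁻ y∈

mainTheorem7 : (π : List ℕ) → IsPerm π → Rectangular π →
    (recoils (ψ₁ π) ≡ recoils π)
    × (2 ≤ length π → first π ≢ 1 → recoils (ψ₂ π) ≡ recoils π)
    × (2 ≤ length π → first π ≢ 1 → recoils (ψu π) ≡ recoils π)
    × (1 ≤ length π → recoils (ψd π) ≡ suc (recoils π))
mainTheorem7 [] _ _ = refl , (λ ()) , (λ ()) , (λ ())
mainTheorem7 π@(_ ∷ rest) perm _ with ∈-IsPerm-bounds perm (here refl)
... | s≤s z≤n , s≤s j≤ =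
    recoils-ψ₁ π
  , (λ _ π₁≢1 → recoils-ψ₂ rest π₁≢1)
  , (λ _ _ → recoils-ψu rest j≤)
  , (λ _ → recoils-ψd rest j≤)
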